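{- For all integers $n,k,r\ge 0$ with $n\ge k$, \[ S_{2}(n,k\,|\,2r)=\sum_{m=k}^{n}(-1)^{n-m}S_{2}(n,m)\,L_{r}(m,k). \]
   Context: For a nonnegative integer $r$ and integers $0\le k\le m$, the $r$-Lah number $L_r(m,k)$ is the number of partitions of a set with $m+r$ elements into $k+r$ non-empty linearly ordered subsets such that $r$ distinguished elements lie in distinct subsets; its exponential generating function is $\sum_{m\ge k}L_r(m,k)\frac{t^m}{m!}=\frac{1}{k!}\left(\frac{1}{1-t}-1\right)^k\left(\frac{1}{1-t}\right)^{2r}$. The Stirling polynomials of the second kind are defined by $\frac1{k!}e^{xt}(e^t-1)^k=\sum_{n\ge k}S_2(n,k\,|\,x)\frac{t^n}{n!}$. The Stirling numbers of the second kind $S_2(n,m)$ are defined by $x^n=\sum_{m=0}^nS_2(n,m)(x)_m$, where $(x)_m=x(x-1)\cdots(x-m+1)$. -}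

module Defs where

open import Data.Nat as ℕ using (ℕ; zero; suc; _!; _∸_)
open import Data.Bool using (true; false)
open import Data.Nat.Properties using (_!≢0)
open import Data.Nat.Combinatorics using (_C_)
open import Data.Integer as ℤ using (ℤ; +_)
open import Data.Rational using (ℚ; 0ℚ; 1ℚ; _+_; _*_; -_; _/_)

ℕ→ℚ : ℕ → ℚ
ℕ→ℚ n = (+ n) / 1

ℤ→ℚ : ℤ → ℚ
ℤ→ℚ z = z / 1

_^ℚ_ : ℚ → ℕ → ℚ
x ^ℚ zero  = 1ℚ
x ^ℚ suc n = x * (x ^ℚ n)

Σ≤ : ℕ → (ℕ → ℚ) → ℚ
Σ≤ zero    f = f 0
Σ≤ (suc n) f = Σ≤ n f + f (suc n)

Σ[_⋯_] : ℕ → ℕ → (ℕ → ℚ) → ℚ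
Σ[ a ⋯ b ] f with b ℕ.<ᵇ a
... | true  = 0ℚ
... | false = Σ≤ (b ∸ a) (λ i → f (a ℕ.+ i))

-- Exponential generating functions, represented by their sequence of
-- "EGF coefficients": the series Σ a n t^n / n!  is represented by a.

EGF : Set
EGF = ℕ → ℚ

-- product of EGFs = binomial convolution
_⊛_ : EGF → EGF → EGF
(a ⊛ b) n = Σ≤ n (λ i → ℕ→ℚ (n C i) * (a i * b (n ∸ i)))

_⊕_ : EGF → EGF → EGF
(a ⊕ b) n = a n + b n

_⊝_ : EGF → EGF → EGF
(a ⊝ b) n = a n + (- b n)

scale : ℚ → EGF → EGF
scale c a n = c * a n

oneE : EGF
oneE zero    = 1ℚ
oneE (suc _) = 0ℚ

_^E_ : EGF → ℕ → EGF
a ^E zero  = oneE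
a ^E suc k = a ⊛ (a ^E k)

expE : ℚ → EGF      -- e^{x t} = Σ x^n t^n / n!
expE x n = x ^ℚ n

geomE : EGF         -- 1/(1-t) = Σ t^n = Σ n! t^n / n!
geomE n = ℕ→ℚ (n !)

inv! : ℕ → ℚ
inv! k = (+ 1) / (k !)
  where instance _ = k !≢0

-- Stirling polynomials of the second kind, from their generating function
--   (1/k!) e^{xt} (e^t - 1)^k = Σ_{n ≥ k} S₂(n,k|x) t^n/n!
S₂poly : ℕ → ℕ → ℚ → ℚ
S₂poly n k x = scale (inv! k) (expE x ⊛ ((expE 1ℚ ⊝ oneE) ^E k)) n

-- r-Lah numbers, from their generating function
--   Σ_{m ≥ k} L_r(m,k) t^m/m! = (1/k!) (1/(1-t) - 1)^k (1/(1-t))^{2r}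
Lah : ℕ → ℕ → ℕ → ℚ
Lah r m k = scale (inv! k) (((geomE ⊝ oneE) ^E k) ⊛ (geomE ^E (2 ℕ.* r))) m

-- Stirling numbers of the second kind S₂(n,m), defined by the standard
-- recurrence (the unique numbers with x^n = Σ_m S₂(n,m) (x)_m).
S₂ : ℕ → ℕ → ℕ
S₂ zero    zero    = 1
S₂ zero    (suc m) = 0
S₂ (suc n) zero    = 0
S₂ (suc n) (suc m) = suc m ℕ.* S₂ n (suc m) ℕ.+ S₂ n m

sign : ℕ → ℚ
sign j = (- 1ℚ) ^ℚ j

{-# OPTIONS --safe #-}
-- Both sides, as triangles in (n, k), satisfy T(n+1,k) = (2r + k) T(n,k) + T(n,k-1) with
-- T(0,k) = [k = 0]. For the Stirling polynomials this is d/dt applied to e^{xt}(e^t - 1)^k / k!.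
-- For the r-Lah numbers, (1 - t) d/dt is a derivation fixing 1/(1-t) and sending t/(1-t) to
-- 1/(1-t), which gives L_r(m+1,k) = (m + 2r + k) L_r(m,k) + L_r(m,k-1); in the alternating sum,
-- S₂(n+1,m) = m S₂(n,m) + S₂(n,m-1) makes the extra terms m L_r(m,k) telescope away.
-- Finally L_r(m,k) = 0 for m < k, so the sum may start at m = k.
module Submission where

open import Defs

module TriangleRecurrences where

  open import Data.Bool as Bool using (true; false)
  open import Data.Empty using (⊥-elim)
  open import Data.Unit using (tt)
  open import Relation.Nullary.Decidable using (dec⇒maybe)
  open import Data.Nat as ℕ using (ℕ; zero; suc; _∸_; _≤_; _<_; z≤n; s≤s; _!)
  import Data.Nat.Properties as ℕₚ
  open import Data.Nat.Combinatorics using (_C_; nCk+nC[k+1]≡[n+1]C[k+1]; k>n⇒nCk≡0)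
  open import Data.Nat.Coprimality using (1-coprimeTo) renaming (sym to coprime-sym)
  import Data.Integer as ℤ
  import Data.Integer.Properties as ℤₚ
  open import Data.Rational using (ℚ; mkℚ; 0ℚ; 1ℚ; _+_; _*_; -_; _/_)
  open import Data.Rational.Properties
    using ( ↥p/↧p≡p; *-inverseʳ; +-*-commutativeRing; _≟_
          ; +-identityˡ; +-identityʳ; +-comm; *-identityˡ; *-identityʳ; *-zeroˡ; *-zeroʳ
          ; *-distribˡ-+; *-distribʳ-+)
  open import Level using (0ℓ)
  open import Relation.Binary.PropositionalEquality
  open import Tactic.RingSolver using (solve-∀)
  open import Tactic.RingSolver.Core.AlmostCommutativeRing
    using (AlmostCommutativeRing; fromCommutativeRing)
  open ≡-Reasoning

  ℚ-ring : AlmostCommutativeRing 0ℓ 0ℓ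
  ℚ-ring = fromCommutativeRing +-*-commutativeRing (λ x → dec⇒maybe (0ℚ ≟ x))

  ℕ→ℚ≡mkℚ : ∀ n → ℕ→ℚ n ≡ mkℚ (ℤ.+ n) 0 (coprime-sym (1-coprimeTo n))
  ℕ→ℚ≡mkℚ n = ↥p/↧p≡p (mkℚ (ℤ.+ n) 0 (coprime-sym (1-coprimeTo n)))

  ℕ→ℚ-+ : ∀ m n → ℕ→ℚ (m ℕ.+ n) ≡ ℕ→ℚ m + ℕ→ℚ n
  ℕ→ℚ-+ m n rewrite ℕ→ℚ≡mkℚ m | ℕ→ℚ≡mkℚ n =
    cong (_/ 1) (sym (cong₂ ℤ._+_ (ℤₚ.*-identityʳ (ℤ.+ m)) (ℤₚ.*-identityʳ (ℤ.+ n))))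

  ℕ→ℚ-* : ∀ m n → ℕ→ℚ (m ℕ.* n) ≡ ℕ→ℚ m * ℕ→ℚ n
  ℕ→ℚ-* m n rewrite ℕ→ℚ≡mkℚ m | ℕ→ℚ≡mkℚ n = cong (_/ 1) (ℤₚ.pos-* m n)

  ℕ→ℚ-suc : ∀ n → ℕ→ℚ (suc n) ≡ 1ℚ + ℕ→ℚ n
  ℕ→ℚ-suc = ℕ→ℚ-+ 1

  x+k*x≡[1+k]*x : ∀ k x → x + ℕ→ℚ k * x ≡ ℕ→ℚ (suc k) * x
  x+k*x≡[1+k]*x k x = begin
    x + ℕ→ℚ k * x         ≡⟨ cong (_+ ℕ→ℚ k * x) (sym (*-identityˡ x)) ⟩
    1ℚ * x + ℕ→ℚ k * x    ≡⟨ sym (*-distribʳ-+ x 1ℚ (ℕ→ℚ k)) ⟩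
    (1ℚ + ℕ→ℚ k) * x      ≡⟨ cong (_* x) (sym (ℕ→ℚ-suc k)) ⟩
    ℕ→ℚ (suc k) * x       ∎

  ℕ→ℚ-*-1/ : ∀ n .{{_ : ℕ.NonZero n}} → ℕ→ℚ n * (ℤ.+ 1 / n) ≡ 1ℚ
  ℕ→ℚ-*-1/ (suc m) =
    trans (cong₂ _*_ (ℕ→ℚ≡mkℚ (suc m)) (↥p/↧p≡p (mkℚ (ℤ.+ 1) m (1-coprimeTo (suc m)))))
          (*-inverseʳ (mkℚ (ℤ.+ suc m) 0 (coprime-sym (1-coprimeTo (suc m)))))

  k!*inv!k≡1 : ∀ k → ℕ→ℚ (k !) * inv! k ≡ 1ℚ
  k!*inv!k≡1 k = ℕ→ℚ-*-1/ (k !) {{ℕₚ._!≢0 k}}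

  inv!-suc : ∀ k → inv! (suc k) * ℕ→ℚ (suc k) ≡ inv! k
  inv!-suc k = begin
    a * s                        ≡⟨ sym (trans (cong (a * s *_) (k!*inv!k≡1 k)) (*-identityʳ (a * s))) ⟩
    a * s * (ℕ→ℚ (k !) * inv! k) ≡⟨ reassoc a s (ℕ→ℚ (k !)) (inv! k) ⟩
    s * ℕ→ℚ (k !) * a * inv! k   ≡⟨ cong (λ z → z * a * inv! k) (sym (ℕ→ℚ-* (suc k) (k !))) ⟩
    ℕ→ℚ (suc k !) * a * inv! k   ≡⟨ cong (_* inv! k) (k!*inv!k≡1 (suc k)) ⟩
    1ℚ * inv! k                  ≡⟨ *-identityˡ (inv! k) ⟩
    inv! k                       ∎
    where
    a = inv! (suc k)
    s = ℕ→ℚ (suc k)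
    reassoc : ∀ a s c b → a * s * (c * b) ≡ s * c * a * b
    reassoc = solve-∀ ℚ-ring

  Σ≤-cong : ∀ n {f g : ℕ → ℚ} → (∀ i → i ≤ n → f i ≡ g i) → Σ≤ n f ≡ Σ≤ n g
  Σ≤-cong zero    f≡g = f≡g 0 z≤n
  Σ≤-cong (suc n) f≡g =
    cong₂ _+_ (Σ≤-cong n (λ i i≤n → f≡g i (ℕₚ.m≤n⇒m≤1+n i≤n))) (f≡g (suc n) ℕₚ.≤-refl)

  Σ≤-zero : ∀ n f → (∀ i → i ≤ n → f i ≡ 0ℚ) → Σ≤ n f ≡ 0ℚ
  Σ≤-zero zero    f f≡0 = f≡0 0 z≤n
  Σ≤-zero (suc n) f f≡0 =
    cong₂ _+_ (Σ≤-zero n f (λ i i≤n → f≡0 i (ℕₚ.m≤n⇒m≤1+n i≤n))) (f≡0 (suc n) ℕₚ.≤-refl)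

  Σ≤-+ : ∀ n f g → Σ≤ n (λ i → f i + g i) ≡ Σ≤ n f + Σ≤ n g
  Σ≤-+ zero    f g = refl
  Σ≤-+ (suc n) f g =
    trans (cong (_+ (f (suc n) + g (suc n))) (Σ≤-+ n f g))
          (interchange (Σ≤ n f) (Σ≤ n g) (f (suc n)) (g (suc n)))
    where
    interchange : ∀ a b c d → (a + b) + (c + d) ≡ (a + c) + (b + d)
    interchange = solve-∀ ℚ-ring

  Σ≤-* : ∀ n c f → Σ≤ n (λ i → c * f i) ≡ c * Σ≤ n f
  Σ≤-* zero    c f = refl
  Σ≤-* (suc n) c f =
    trans (cong (_+ c * f (suc n)) (Σ≤-* n c f)) (sym (*-distribˡ-+ c (Σ≤ n f) (f (suc n))))

  Σ≤-neg : ∀ n f → Σ≤ n (λ i → - f i) ≡ - Σ≤ n f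
  Σ≤-neg zero    f = refl
  Σ≤-neg (suc n) f = trans (cong (_+ - f (suc n)) (Σ≤-neg n f)) (neg-+ (Σ≤ n f) (f (suc n)))
    where
    neg-+ : ∀ a b → - a + - b ≡ - (a + b)
    neg-+ = solve-∀ ℚ-ring

  Σ≤-head : ∀ n f → Σ≤ (suc n) f ≡ f 0 + Σ≤ n (λ i → f (suc i))
  Σ≤-head zero    f = refl
  Σ≤-head (suc n) f =
    trans (cong (_+ f (suc (suc n))) (Σ≤-head n f)) (+-assoc′ (f 0) (Σ≤ n (λ i → f (suc i))) (f (suc (suc n))))
    where
    +-assoc′ : ∀ a b c → (a + b) + c ≡ a + (b + c)
    +-assoc′ = solve-∀ ℚ-ring

  Σ≤-skip-zeros : ∀ k j f → (∀ i → i < k → f i ≡ 0ℚ) → Σ≤ (k ℕ.+ j) f ≡ Σ≤ j (λ i → f (k ℕ.+ i))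
  Σ≤-skip-zeros zero    j f f<k≡0 = refl
  Σ≤-skip-zeros (suc k) j f f<k≡0 = begin
    Σ≤ (suc (k ℕ.+ j)) f                        ≡⟨ Σ≤-head (k ℕ.+ j) f ⟩
    f 0 + Σ≤ (k ℕ.+ j) (λ i → f (suc i))        ≡⟨ cong₂ _+_ (f<k≡0 0 (s≤s z≤n)) tail ⟩
    0ℚ + Σ≤ j (λ i → f (suc (k ℕ.+ i)))         ≡⟨ +-identityˡ _ ⟩
    Σ≤ j (λ i → f (suc k ℕ.+ i))                ∎
    where
    tail = Σ≤-skip-zeros k j (λ i → f (suc i)) (λ i i<k → f<k≡0 (suc i) (s≤s i<k))

  Σ[⋯]≡Σ≤ : ∀ {k n} f → k ≤ n → (∀ i → i < k → f i ≡ 0ℚ) → Σ[ k ⋯ n ] f ≡ Σ≤ n f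
  Σ[⋯]≡Σ≤ {k} {n} f k≤n f<k≡0 with n ℕ.<ᵇ k in n<ᵇk
  ... | true  = ⊥-elim (ℕₚ.<⇒≱ (ℕₚ.<ᵇ⇒< n k (subst Bool.T (sym n<ᵇk) tt)) k≤n)
  ... | false = begin
    Σ≤ (n ∸ k) (λ i → f (k ℕ.+ i)) ≡⟨ Σ≤-skip-zeros k (n ∸ k) f f<k≡0 ⟨
    Σ≤ (k ℕ.+ (n ∸ k)) f           ≡⟨ cong (λ m → Σ≤ m f) (ℕₚ.m+[n∸m]≡n k≤n) ⟩
    Σ≤ n f                         ∎

  Σ≤-alternating-telescope : ∀ n (h : ℕ → ℚ) →
    Σ≤ n (λ m → sign (n ∸ m) * (h (suc m) + h m)) ≡ h (suc n) + sign n * h 0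
  Σ≤-alternating-telescope zero    h = base (h 1) (h 0)
    where
    base : ∀ x y → 1ℚ * (x + y) ≡ x + 1ℚ * y
    base = solve-∀ ℚ-ring
  Σ≤-alternating-telescope (suc n) h = begin
    Σ≤ n (λ m → sign (suc n ∸ m) * g m) + sign (suc n ∸ suc n) * g (suc n)
      ≡⟨ cong₂ _+_ flip-signs (cong (λ j → sign j * g (suc n)) (ℕₚ.n∸n≡0 n)) ⟩
    - Σ≤ n (λ m → sign (n ∸ m) * g m) + 1ℚ * g (suc n)
      ≡⟨ cong (λ z → - z + 1ℚ * g (suc n)) (Σ≤-alternating-telescope n h) ⟩
    - (h (suc n) + sign n * h 0) + 1ℚ * (h (suc (suc n)) + h (suc n))
      ≡⟨ cancel (h (suc n)) (h (suc (suc n))) (sign n) (h 0) ⟩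
    h (suc (suc n)) + sign (suc n) * h 0 ∎
    where
    g : ℕ → ℚ
    g m = h (suc m) + h m
    negate : ∀ s x → (- 1ℚ * s) * x ≡ - (s * x)
    negate = solve-∀ ℚ-ring
    cancel : ∀ a b s z → - (a + s * z) + 1ℚ * (b + a) ≡ b + (- 1ℚ * s) * z
    cancel = solve-∀ ℚ-ring
    flip-signs : Σ≤ n (λ m → sign (suc n ∸ m) * g m) ≡ - Σ≤ n (λ m → sign (n ∸ m) * g m)
    flip-signs = trans (Σ≤-cong n (λ m m≤n → trans (cong (λ j → sign j * g m) (ℕₚ.+-∸-assoc 1 m≤n))
                                                   (negate (sign (n ∸ m)) (g m))))
                       (Σ≤-neg n _)

  -- Exponential generating functions and derivations

  ⊛-congˡ : ∀ {a a′} b → a ≗ a′ → a ⊛ b ≗ a′ ⊛ b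
  ⊛-congˡ b a≗a′ n = Σ≤-cong n (λ i _ → cong (λ x → ℕ→ℚ (n C i) * (x * b (n ∸ i))) (a≗a′ i))

  ⊛-congʳ : ∀ a {b b′} → b ≗ b′ → a ⊛ b ≗ a ⊛ b′
  ⊛-congʳ a b≗b′ n = Σ≤-cong n (λ i _ → cong (λ y → ℕ→ℚ (n C i) * (a i * y)) (b≗b′ (n ∸ i)))

  ⊛-at-0 : ∀ a b → (a ⊛ b) 0 ≡ a 0 * b 0
  ⊛-at-0 a b = *-identityˡ (a 0 * b 0)

  ⊛-identityˡ : ∀ a → oneE ⊛ a ≗ a
  ⊛-identityˡ a zero    = trans (*-identityˡ _) (*-identityˡ (a 0))
  ⊛-identityˡ a (suc n) = begin
    (oneE ⊛ a) (suc n)                                                       ≡⟨ Σ≤-head n _ ⟩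
    1ℚ * (1ℚ * a (suc n)) + Σ≤ n (λ i → ℕ→ℚ (suc n C suc i) * (0ℚ * a (n ∸ i)))
      ≡⟨ cong₂ _+_ (trans (*-identityˡ _) (*-identityˡ (a (suc n))))
                   (Σ≤-zero n _ (λ i _ → trans (cong (ℕ→ℚ (suc n C suc i) *_) (*-zeroˡ (a (n ∸ i))))
                                               (*-zeroʳ (ℕ→ℚ (suc n C suc i))))) ⟩
    a (suc n) + 0ℚ                                                           ≡⟨ +-identityʳ (a (suc n)) ⟩
    a (suc n)                                                                ∎

  ⊛-distribʳ-⊕ : ∀ a b c → (a ⊕ b) ⊛ c ≗ (a ⊛ c) ⊕ (b ⊛ c)
  ⊛-distribʳ-⊕ a b c n =
    trans (Σ≤-cong n (λ i _ → distrib (ℕ→ℚ (n C i)) (a i) (b i) (c (n ∸ i)))) (Σ≤-+ n _ _)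
    where
    distrib : ∀ k x y z → k * ((x + y) * z) ≡ k * (x * z) + k * (y * z)
    distrib = solve-∀ ℚ-ring

  ⊛-distribˡ-⊕ : ∀ a b c → a ⊛ (b ⊕ c) ≗ (a ⊛ b) ⊕ (a ⊛ c)
  ⊛-distribˡ-⊕ a b c n =
    trans (Σ≤-cong n (λ i _ → distrib (ℕ→ℚ (n C i)) (a i) (b (n ∸ i)) (c (n ∸ i)))) (Σ≤-+ n _ _)
    where
    distrib : ∀ k x y z → k * (x * (y + z)) ≡ k * (x * y) + k * (x * z)
    distrib = solve-∀ ℚ-ring

  ⊛-distribʳ-⊝ : ∀ a b c → (a ⊝ b) ⊛ c ≗ (a ⊛ c) ⊝ (b ⊛ c)
  ⊛-distribʳ-⊝ a b c n =
    trans (Σ≤-cong n (λ i _ → distrib (ℕ→ℚ (n C i)) (a i) (b i) (c (n ∸ i))))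
          (trans (Σ≤-+ n _ _) (cong ((a ⊛ c) n +_) (Σ≤-neg n _)))
    where
    distrib : ∀ k x y z → k * ((x + - y) * z) ≡ k * (x * z) + - (k * (y * z))
    distrib = solve-∀ ℚ-ring

  ⊛-distribˡ-⊝ : ∀ a b c → a ⊛ (b ⊝ c) ≗ (a ⊛ b) ⊝ (a ⊛ c)
  ⊛-distribˡ-⊝ a b c n =
    trans (Σ≤-cong n (λ i _ → distrib (ℕ→ℚ (n C i)) (a i) (b (n ∸ i)) (c (n ∸ i))))
          (trans (Σ≤-+ n _ _) (cong ((a ⊛ b) n +_) (Σ≤-neg n _)))
    where
    distrib : ∀ k x y z → k * (x * (y + - z)) ≡ k * (x * y) + - (k * (x * z))
    distrib = solve-∀ ℚ-ring

  ⊛-scaleˡ : ∀ s a b → scale s a ⊛ b ≗ scale s (a ⊛ b)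
  ⊛-scaleˡ s a b n = trans (Σ≤-cong n (λ i _ → pull (ℕ→ℚ (n C i)) s (a i) (b (n ∸ i)))) (Σ≤-* n s _)
    where
    pull : ∀ k s x y → k * ((s * x) * y) ≡ s * (k * (x * y))
    pull = solve-∀ ℚ-ring

  ⊛-scaleʳ : ∀ s a b → a ⊛ scale s b ≗ scale s (a ⊛ b)
  ⊛-scaleʳ s a b n = trans (Σ≤-cong n (λ i _ → pull (ℕ→ℚ (n C i)) s (a i) (b (n ∸ i)))) (Σ≤-* n s _)
    where
    pull : ∀ k s x y → k * (x * (s * y)) ≡ s * (k * (x * y))
    pull = solve-∀ ℚ-ring

  ^E-at-0 : ∀ a k → (a ^E k) 0 ≡ a 0 ^ℚ k
  ^E-at-0 a zero    = refl
  ^E-at-0 a (suc k) = trans (⊛-at-0 a (a ^E k)) (cong (a 0 *_) (^E-at-0 a k))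

  0^ℚ≡oneE : ∀ k → 0ℚ ^ℚ k ≡ oneE k
  0^ℚ≡oneE zero    = refl
  0^ℚ≡oneE (suc k) = *-zeroˡ (0ℚ ^ℚ k)

  1^ℚ≡1 : ∀ k → 1ℚ ^ℚ k ≡ 1ℚ
  1^ℚ≡1 zero    = refl
  1^ℚ≡1 (suc k) = trans (*-identityˡ (1ℚ ^ℚ k)) (1^ℚ≡1 k)

  -- At k = 0 the truncated k ∸ 1 is junk, killed by the factor k.
  k*[E⊛Eᵏ⁻¹]≡k*Eᵏ : ∀ E k n → ℕ→ℚ k * (E ⊛ (E ^E (k ∸ 1))) n ≡ ℕ→ℚ k * (E ^E k) n
  k*[E⊛Eᵏ⁻¹]≡k*Eᵏ E zero    n = trans (*-zeroˡ ((E ⊛ oneE) n)) (sym (*-zeroˡ (oneE n)))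
  k*[E⊛Eᵏ⁻¹]≡k*Eᵏ E (suc k) n = refl

  IsDerivation : (EGF → EGF) → Set
  IsDerivation δ = ∀ a b → δ (a ⊛ b) ≗ (δ a ⊛ b) ⊕ (a ⊛ δ b)

  -- On EGF coefficients d/dt is the shift, and t d/dt multiplies the n-th coefficient by n.
  ∂ : EGF → EGF
  ∂ a n = a (suc n)

  t∂ : EGF → EGF
  t∂ a n = ℕ→ℚ n * a n

  [1-t]∂ : EGF → EGF
  [1-t]∂ a = ∂ a ⊝ t∂ a

  ∂-leibniz : IsDerivation ∂
  ∂-leibniz a b n = begin
    Σ≤ (suc n) (λ i → ℕ→ℚ (suc n C i) * h i)                        ≡⟨ Σ≤-cong (suc n) (λ i _ → pascal i) ⟩
    Σ≤ (suc n) (λ i → ℕ→ℚ (n C i) * h i + shifted i)                 ≡⟨ Σ≤-+ (suc n) _ shifted ⟩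
    Σ≤ (suc n) (λ i → ℕ→ℚ (n C i) * h i) + Σ≤ (suc n) shifted        ≡⟨ cong₂ _+_ unshifted-sum shifted-sum ⟩
    (a ⊛ ∂ b) n + (∂ a ⊛ b) n                                        ≡⟨ +-comm ((a ⊛ ∂ b) n) _ ⟩
    (∂ a ⊛ b) n + (a ⊛ ∂ b) n                                        ∎
    where
    h : ℕ → ℚ
    h i = a i * b (suc n ∸ i)
    shifted : ℕ → ℚ
    shifted zero    = 0ℚ
    shifted (suc i) = ℕ→ℚ (n C i) * h (suc i)
    pascal : ∀ i → ℕ→ℚ (suc n C i) * h i ≡ ℕ→ℚ (n C i) * h i + shifted i
    pascal zero    = sym (+-identityʳ _)
    pascal (suc i) = begin
      ℕ→ℚ (suc n C suc i) * h (suc i)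
        ≡⟨ cong (λ m → ℕ→ℚ m * h (suc i)) (sym (nCk+nC[k+1]≡[n+1]C[k+1] n i)) ⟩
      ℕ→ℚ (n C i ℕ.+ n C suc i) * h (suc i)
        ≡⟨ cong (_* h (suc i)) (trans (ℕ→ℚ-+ (n C i) (n C suc i)) (+-comm (ℕ→ℚ (n C i)) _)) ⟩
      (ℕ→ℚ (n C suc i) + ℕ→ℚ (n C i)) * h (suc i)
        ≡⟨ *-distribʳ-+ (h (suc i)) (ℕ→ℚ (n C suc i)) (ℕ→ℚ (n C i)) ⟩
      ℕ→ℚ (n C suc i) * h (suc i) + shifted (suc i) ∎
    unshifted-sum : Σ≤ (suc n) (λ i → ℕ→ℚ (n C i) * h i) ≡ (a ⊛ ∂ b) n
    unshifted-sum = begin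
      Σ≤ n (λ i → ℕ→ℚ (n C i) * h i) + ℕ→ℚ (n C suc n) * h (suc n)
        ≡⟨ cong (λ m → Σ≤ n (λ i → ℕ→ℚ (n C i) * h i) + ℕ→ℚ m * h (suc n)) (k>n⇒nCk≡0 (ℕₚ.n<1+n n)) ⟩
      Σ≤ n (λ i → ℕ→ℚ (n C i) * h i) + 0ℚ * h (suc n)
        ≡⟨ trans (cong (Σ≤ n (λ i → ℕ→ℚ (n C i) * h i) +_) (*-zeroˡ (h (suc n)))) (+-identityʳ _) ⟩
      Σ≤ n (λ i → ℕ→ℚ (n C i) * h i)
        ≡⟨ Σ≤-cong n (λ i i≤n → cong (λ j → ℕ→ℚ (n C i) * (a i * b j)) (ℕₚ.+-∸-assoc 1 i≤n)) ⟩
      (a ⊛ ∂ b) n ∎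
    shifted-sum : Σ≤ (suc n) shifted ≡ (∂ a ⊛ b) n
    shifted-sum = trans (Σ≤-head n shifted) (+-identityˡ _)

  t∂-leibniz : IsDerivation t∂
  t∂-leibniz a b n = begin
    ℕ→ℚ n * Σ≤ n term               ≡⟨ Σ≤-* n (ℕ→ℚ n) term ⟨
    Σ≤ n (λ i → ℕ→ℚ n * term i)     ≡⟨ Σ≤-cong n split ⟩
    Σ≤ n (λ i → left i + right i)   ≡⟨ Σ≤-+ n left right ⟩
    (t∂ a ⊛ b) n + (a ⊛ t∂ b) n     ∎
    where
    term left right : ℕ → ℚ
    term  i = ℕ→ℚ (n C i) * (a i * b (n ∸ i))
    left  i = ℕ→ℚ (n C i) * (t∂ a i * b (n ∸ i))
    right i = ℕ→ℚ (n C i) * (a i * t∂ b (n ∸ i))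
    distrib : ∀ p q k x y → (p + q) * (k * (x * y)) ≡ k * ((p * x) * y) + k * (x * (q * y))
    distrib = solve-∀ ℚ-ring
    split : ∀ i → i ≤ n → ℕ→ℚ n * term i ≡ left i + right i
    split i i≤n = begin
      ℕ→ℚ n * term i                   ≡⟨ cong (λ m → ℕ→ℚ m * term i) (ℕₚ.m+[n∸m]≡n i≤n) ⟨
      ℕ→ℚ (i ℕ.+ (n ∸ i)) * term i     ≡⟨ cong (_* term i) (ℕ→ℚ-+ i (n ∸ i)) ⟩
      (ℕ→ℚ i + ℕ→ℚ (n ∸ i)) * term i   ≡⟨ distrib (ℕ→ℚ i) (ℕ→ℚ (n ∸ i)) (ℕ→ℚ (n C i)) (a i) (b (n ∸ i)) ⟩
      left i + right i                 ∎

  ⊝-leibniz : ∀ {δ₁ δ₂} → IsDerivation δ₁ → IsDerivation δ₂ → IsDerivation (λ a → δ₁ a ⊝ δ₂ a)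
  ⊝-leibniz {δ₁} {δ₂} δ₁-leibniz δ₂-leibniz a b n = begin
    δ₁ (a ⊛ b) n + - δ₂ (a ⊛ b) n
      ≡⟨ cong₂ (λ x y → x + - y) (δ₁-leibniz a b n) (δ₂-leibniz a b n) ⟩
    ((δ₁ a ⊛ b) n + (a ⊛ δ₁ b) n) + - ((δ₂ a ⊛ b) n + (a ⊛ δ₂ b) n)
      ≡⟨ regroup ((δ₁ a ⊛ b) n) ((a ⊛ δ₁ b) n) ((δ₂ a ⊛ b) n) ((a ⊛ δ₂ b) n) ⟩
    ((δ₁ a ⊛ b) n + - (δ₂ a ⊛ b) n) + ((a ⊛ δ₁ b) n + - (a ⊛ δ₂ b) n)
      ≡⟨ cong₂ _+_ (⊛-distribʳ-⊝ (δ₁ a) (δ₂ a) b n) (⊛-distribˡ-⊝ a (δ₁ b) (δ₂ b) n) ⟨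
    ((δ₁ a ⊝ δ₂ a) ⊛ b) n + (a ⊛ (δ₁ b ⊝ δ₂ b)) n ∎
    where
    regroup : ∀ p q r s → (p + q) + - (r + s) ≡ (p + - r) + (q + - s)
    regroup = solve-∀ ℚ-ring

  module PowerRules (δ : EGF → EGF) (δ-leibniz : IsDerivation δ) (δ-oneE : ∀ n → δ oneE n ≡ 0ℚ) where

    ^E-eigen : ∀ {g} → δ g ≗ g → ∀ j → δ (g ^E j) ≗ scale (ℕ→ℚ j) (g ^E j)
    ^E-eigen δg≗g zero    n = trans (δ-oneE n) (sym (*-zeroˡ (oneE n)))
    ^E-eigen {g} δg≗g (suc j) n = begin
      δ (g ⊛ (g ^E j)) n                           ≡⟨ δ-leibniz g (g ^E j) n ⟩
      (δ g ⊛ (g ^E j)) n + (g ⊛ δ (g ^E j)) n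
        ≡⟨ cong₂ _+_ (⊛-congˡ (g ^E j) δg≗g n)
                     (trans (⊛-congʳ g (^E-eigen δg≗g j) n) (⊛-scaleʳ (ℕ→ℚ j) g (g ^E j) n)) ⟩
      (g ^E suc j) n + ℕ→ℚ j * (g ^E suc j) n     ≡⟨ x+k*x≡[1+k]*x j _ ⟩
      ℕ→ℚ (suc j) * (g ^E suc j) n                ∎

    ^E-affine : ∀ {E} → δ E ≗ E ⊕ oneE → ∀ k → δ (E ^E k) ≗ scale (ℕ→ℚ k) ((E ^E k) ⊕ (E ^E (k ∸ 1)))
    ^E-affine δE≗E+1 zero    n = trans (δ-oneE n) (sym (*-zeroˡ (oneE n + oneE n)))
    ^E-affine {E} δE≗E+1 (suc k) n = begin
      δ (E ⊛ Eᵏ) n                               ≡⟨ δ-leibniz E Eᵏ n ⟩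
      (δ E ⊛ Eᵏ) n + (E ⊛ δ Eᵏ) n                ≡⟨ cong₂ _+_ from-δE from-δEᵏ ⟩
      (Eᵏ⁺¹ n + Eᵏ n) + ℕ→ℚ k * (Eᵏ⁺¹ n + Eᵏ n)  ≡⟨ x+k*x≡[1+k]*x k _ ⟩
      ℕ→ℚ (suc k) * (Eᵏ⁺¹ n + Eᵏ n)              ∎
      where
      Eᵏ Eᵏ⁺¹ : EGF
      Eᵏ = E ^E k
      Eᵏ⁺¹ = E ^E suc k
      from-δE : (δ E ⊛ Eᵏ) n ≡ Eᵏ⁺¹ n + Eᵏ n
      from-δE = trans (⊛-congˡ Eᵏ δE≗E+1 n)
                      (trans (⊛-distribʳ-⊕ E oneE Eᵏ n) (cong (Eᵏ⁺¹ n +_) (⊛-identityˡ Eᵏ n)))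
      from-δEᵏ : (E ⊛ δ Eᵏ) n ≡ ℕ→ℚ k * (Eᵏ⁺¹ n + Eᵏ n)
      from-δEᵏ = begin
        (E ⊛ δ Eᵏ) n
          ≡⟨ trans (⊛-congʳ E (^E-affine δE≗E+1 k) n) (⊛-scaleʳ (ℕ→ℚ k) E (Eᵏ ⊕ (E ^E (k ∸ 1))) n) ⟩
        ℕ→ℚ k * (E ⊛ (Eᵏ ⊕ (E ^E (k ∸ 1)))) n
          ≡⟨ trans (cong (ℕ→ℚ k *_) (⊛-distribˡ-⊕ E Eᵏ (E ^E (k ∸ 1)) n)) (*-distribˡ-+ (ℕ→ℚ k) _ _) ⟩
        ℕ→ℚ k * Eᵏ⁺¹ n + ℕ→ℚ k * (E ⊛ (E ^E (k ∸ 1))) n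
          ≡⟨ cong (ℕ→ℚ k * Eᵏ⁺¹ n +_) (k*[E⊛Eᵏ⁻¹]≡k*Eᵏ E k n) ⟩
        ℕ→ℚ k * Eᵏ⁺¹ n + ℕ→ℚ k * Eᵏ n
          ≡⟨ *-distribˡ-+ (ℕ→ℚ k) _ _ ⟨
        ℕ→ℚ k * (Eᵏ⁺¹ n + Eᵏ n) ∎

  -- Triangles with a Stirling-type recurrence

  prev : (ℕ → ℚ) → ℕ → ℚ
  prev f zero    = 0ℚ
  prev f (suc k) = f k

  record Recurrence (a : ℕ → ℚ) (T : ℕ → ℕ → ℚ) : Set where
    field step : ∀ n k → T (suc n) k ≡ (a n + ℕ→ℚ k) * T n k + prev (T n) k
  open Recurrence

  recurrence-unique : ∀ {a T T′} → Recurrence a T → Recurrence a T′ →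
                      (∀ k → T 0 k ≡ T′ 0 k) → ∀ n k → T n k ≡ T′ n k
  recurrence-unique recT recT′ T≡T′ zero    k = T≡T′ k
  recurrence-unique {a} {T} {T′} recT recT′ T≡T′ (suc n) k = begin
    T (suc n) k                                ≡⟨ recT .step n k ⟩
    (a n + ℕ→ℚ k) * T n k + prev (T n) k       ≡⟨ cong₂ (λ x y → (a n + ℕ→ℚ k) * x + y) (IH k) (prev-IH k) ⟩
    (a n + ℕ→ℚ k) * T′ n k + prev (T′ n) k     ≡⟨ recT′ .step n k ⟨
    T′ (suc n) k                               ∎
    where
    IH : ∀ j → T n j ≡ T′ n j
    IH = recurrence-unique recT recT′ T≡T′ n
    prev-IH : ∀ j → prev (T n) j ≡ prev (T′ n) j
    prev-IH zero    = refl
    prev-IH (suc j) = IH j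

  recurrence-lowerTriangular : ∀ {a T} → Recurrence a T → (∀ k → T 0 (suc k) ≡ 0ℚ) →
                               ∀ {m k} → m < k → T m k ≡ 0ℚ
  recurrence-lowerTriangular recT T₀≡0 {zero}  {suc k} _ = T₀≡0 k
  recurrence-lowerTriangular {a} {T} recT T₀≡0 {suc m} {suc k} (s≤s m<k) = begin
    T (suc m) (suc k)                                   ≡⟨ recT .step m (suc k) ⟩
    (a m + ℕ→ℚ (suc k)) * T m (suc k) + T m k
      ≡⟨ cong₂ (λ x y → (a m + ℕ→ℚ (suc k)) * x + y)
               (recurrence-lowerTriangular recT T₀≡0 (ℕₚ.m<n⇒m<1+n m<k))
               (recurrence-lowerTriangular recT T₀≡0 m<k) ⟩
    (a m + ℕ→ℚ (suc k)) * 0ℚ + 0ℚ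
      ≡⟨ trans (+-identityʳ _) (*-zeroʳ (a m + ℕ→ℚ (suc k))) ⟩
    0ℚ                                                  ∎

  inv!*k*[k-1]≡prev : ∀ k (g : ℕ → ℚ) → inv! k * ℕ→ℚ k * g (k ∸ 1) ≡ prev (λ j → inv! j * g j) k
  inv!*k*[k-1]≡prev zero    g = trans (cong (_* g 0) (*-zeroʳ (inv! 0))) (*-zeroˡ (g 0))
  inv!*k*[k-1]≡prev (suc k) g = cong (_* g k) (inv!-suc k)

  recurrence-from-derivation :
    (δ : EGF → EGF) (w : ℕ → ℚ) → (∀ a n → a (suc n) ≡ δ a n + w n * a n) →
    (F : ℕ → EGF) (c : ℚ) → (∀ k → δ (F k) ≗ scale (ℕ→ℚ k) (F k ⊕ F (k ∸ 1)) ⊕ scale c (F k)) →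
    Recurrence (λ n → w n + c) (λ n k → inv! k * F k n)
  recurrence-from-derivation δ w δ-shift F c δF .step n k = begin
    inv! k * F k (suc n)
      ≡⟨ cong (inv! k *_) (trans (δ-shift (F k) n) (cong (_+ w n * F k n) (δF k n))) ⟩
    inv! k * ((ℕ→ℚ k * (F k n + F (k ∸ 1) n) + c * F k n) + w n * F k n)
      ≡⟨ regroup (inv! k) (ℕ→ℚ k) c (w n) (F k n) (F (k ∸ 1) n) ⟩
    (w n + c + ℕ→ℚ k) * (inv! k * F k n) + inv! k * ℕ→ℚ k * F (k ∸ 1) n
      ≡⟨ cong ((w n + c + ℕ→ℚ k) * (inv! k * F k n) +_) (inv!*k*[k-1]≡prev k (λ j → F j n)) ⟩
    (w n + c + ℕ→ℚ k) * (inv! k * F k n) + prev (λ j → inv! j * F j n) k ∎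
    where
    regroup : ∀ i k c w x y → i * ((k * (x + y) + c * x) + w * x) ≡ (w + c + k) * (i * x) + i * k * y
    regroup = solve-∀ ℚ-ring

  -- Stirling polynomials

  ∂-shift : ∀ a n → a (suc n) ≡ ∂ a n + 0ℚ * a n
  ∂-shift a n = sym (trans (cong (a (suc n) +_) (*-zeroˡ (a n))) (+-identityʳ (a (suc n))))

  module ∂-powers = PowerRules ∂ ∂-leibniz (λ _ → refl)

  expm1 : EGF
  expm1 = expE 1ℚ ⊝ oneE

  ∂-expm1 : ∂ expm1 ≗ expm1 ⊕ oneE
  ∂-expm1 n = regroup (1ℚ ^ℚ n) (oneE n)
    where
    regroup : ∀ p q → 1ℚ * p + - 0ℚ ≡ (p + - q) + q
    regroup = solve-∀ ℚ-ring

  -- S₂poly n k x unfolds to inv! k * stirlingGF x k n, and Lah r m k to inv! k * lahGF r k m.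
  stirlingGF : ℚ → ℕ → EGF
  stirlingGF x k = expE x ⊛ (expm1 ^E k)

  ∂-stirlingGF : ∀ x k → ∂ (stirlingGF x k) ≗
                 scale (ℕ→ℚ k) (stirlingGF x k ⊕ stirlingGF x (k ∸ 1)) ⊕ scale x (stirlingGF x k)
  ∂-stirlingGF x k n = begin
    ∂ (expE x ⊛ (expm1 ^E k)) n
      ≡⟨ ∂-leibniz (expE x) (expm1 ^E k) n ⟩
    (∂ (expE x) ⊛ (expm1 ^E k)) n + (expE x ⊛ ∂ (expm1 ^E k)) n
      ≡⟨ +-comm ((∂ (expE x) ⊛ (expm1 ^E k)) n) _ ⟩
    (expE x ⊛ ∂ (expm1 ^E k)) n + (∂ (expE x) ⊛ (expm1 ^E k)) n
      ≡⟨ cong₂ _+_ powers (⊛-scaleˡ x (expE x) (expm1 ^E k) n) ⟩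
    ℕ→ℚ k * (stirlingGF x k n + stirlingGF x (k ∸ 1) n) + x * stirlingGF x k n ∎
    where
    powers : (expE x ⊛ ∂ (expm1 ^E k)) n ≡ ℕ→ℚ k * (stirlingGF x k n + stirlingGF x (k ∸ 1) n)
    powers = trans (⊛-congʳ (expE x) (∂-powers.^E-affine ∂-expm1 k) n)
               (trans (⊛-scaleʳ (ℕ→ℚ k) (expE x) ((expm1 ^E k) ⊕ (expm1 ^E (k ∸ 1))) n)
                 (cong (ℕ→ℚ k *_) (⊛-distribˡ-⊕ (expE x) (expm1 ^E k) (expm1 ^E (k ∸ 1)) n)))

  S₂poly-recurrence : ∀ x → Recurrence (λ _ → x) (λ n k → S₂poly n k x)
  S₂poly-recurrence x .step n k =
    trans (recurrence-from-derivation ∂ (λ _ → 0ℚ) ∂-shift (stirlingGF x) x (∂-stirlingGF x) .step n k)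
          (cong (λ a → (a + ℕ→ℚ k) * S₂poly n k x + prev (λ j → S₂poly n j x) k) (+-identityˡ x))

  S₂poly-0 : ∀ x k → S₂poly 0 k x ≡ inv! k * oneE k
  S₂poly-0 x k = cong (inv! k *_) (begin
    (expE x ⊛ (expm1 ^E k)) 0  ≡⟨ ⊛-at-0 (expE x) (expm1 ^E k) ⟩
    1ℚ * (expm1 ^E k) 0        ≡⟨ *-identityˡ _ ⟩
    (expm1 ^E k) 0             ≡⟨ ^E-at-0 expm1 k ⟩
    0ℚ ^ℚ k                    ≡⟨ 0^ℚ≡oneE k ⟩
    oneE k                     ∎)

  -- r-Lah numbers

  [1-t]∂-shift : ∀ a n → a (suc n) ≡ [1-t]∂ a n + ℕ→ℚ n * a n
  [1-t]∂-shift a n = regroup (a (suc n)) (ℕ→ℚ n * a n)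
    where
    regroup : ∀ x y → x ≡ (x + - y) + y
    regroup = solve-∀ ℚ-ring

  [1-t]∂-leibniz : IsDerivation [1-t]∂
  [1-t]∂-leibniz = ⊝-leibniz {∂} {t∂} ∂-leibniz t∂-leibniz

  ℕ→ℚ-*-oneE : ∀ n → ℕ→ℚ n * oneE n ≡ 0ℚ
  ℕ→ℚ-*-oneE zero    = refl
  ℕ→ℚ-*-oneE (suc n) = *-zeroʳ (ℕ→ℚ (suc n))

  [1-t]∂-oneE : ∀ n → [1-t]∂ oneE n ≡ 0ℚ
  [1-t]∂-oneE n = cong (λ z → oneE (suc n) + - z) (ℕ→ℚ-*-oneE n)

  module [1-t]∂-powers = PowerRules [1-t]∂ [1-t]∂-leibniz [1-t]∂-oneE

  ℕ→ℚ-suc-! : ∀ n → ℕ→ℚ (suc n !) ≡ ℕ→ℚ (n !) + ℕ→ℚ n * ℕ→ℚ (n !)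
  ℕ→ℚ-suc-! n = trans (ℕ→ℚ-+ (n !) (n ℕ.* n !)) (cong (ℕ→ℚ (n !) +_) (ℕ→ℚ-* n (n !)))

  [1-t]∂-geomE : [1-t]∂ geomE ≗ geomE
  [1-t]∂-geomE n =
    trans (cong (λ z → z + - (ℕ→ℚ n * ℕ→ℚ (n !))) (ℕ→ℚ-suc-! n)) (cancel (ℕ→ℚ (n !)) (ℕ→ℚ n))
    where
    cancel : ∀ f m → (f + m * f) + - (m * f) ≡ f
    cancel = solve-∀ ℚ-ring

  t/[1-t] : EGF
  t/[1-t] = geomE ⊝ oneE

  [1-t]∂-t/[1-t] : [1-t]∂ t/[1-t] ≗ t/[1-t] ⊕ oneE
  [1-t]∂-t/[1-t] n = begin
    (ℕ→ℚ (suc n !) + - 0ℚ) + - (ℕ→ℚ n * (ℕ→ℚ (n !) + - oneE n))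
      ≡⟨ cong (λ z → (z + - 0ℚ) + - (ℕ→ℚ n * (ℕ→ℚ (n !) + - oneE n))) (ℕ→ℚ-suc-! n) ⟩
    ((ℕ→ℚ (n !) + ℕ→ℚ n * ℕ→ℚ (n !)) + - 0ℚ) + - (ℕ→ℚ n * (ℕ→ℚ (n !) + - oneE n))
      ≡⟨ regroup (ℕ→ℚ (n !)) (ℕ→ℚ n) (oneE n) ⟩
    t/[1-t] n + oneE n + ℕ→ℚ n * oneE n
      ≡⟨ trans (cong (t/[1-t] n + oneE n +_) (ℕ→ℚ-*-oneE n)) (+-identityʳ _) ⟩
    t/[1-t] n + oneE n ∎
    where
    regroup : ∀ f m o → ((f + m * f) + - 0ℚ) + - (m * (f + - o)) ≡ ((f + - o) + o) + m * o
    regroup = solve-∀ ℚ-ring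

  lahGF : ℕ → ℕ → EGF
  lahGF r k = (t/[1-t] ^E k) ⊛ (geomE ^E (2 ℕ.* r))

  [1-t]∂-lahGF : ∀ r k → [1-t]∂ (lahGF r k) ≗
                 scale (ℕ→ℚ k) (lahGF r k ⊕ lahGF r (k ∸ 1)) ⊕ scale (ℕ→ℚ (2 ℕ.* r)) (lahGF r k)
  [1-t]∂-lahGF r k n = begin
    [1-t]∂ (Uᵏ ⊛ G) n                            ≡⟨ [1-t]∂-leibniz Uᵏ G n ⟩
    ([1-t]∂ Uᵏ ⊛ G) n + (Uᵏ ⊛ [1-t]∂ G) n        ≡⟨ cong₂ _+_ powers eigen ⟩
    ℕ→ℚ k * (lahGF r k n + lahGF r (k ∸ 1) n) + ℕ→ℚ (2 ℕ.* r) * lahGF r k n ∎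
    where
    Uᵏ G : EGF
    Uᵏ = t/[1-t] ^E k
    G = geomE ^E (2 ℕ.* r)
    powers : ([1-t]∂ Uᵏ ⊛ G) n ≡ ℕ→ℚ k * (lahGF r k n + lahGF r (k ∸ 1) n)
    powers = trans (⊛-congˡ G ([1-t]∂-powers.^E-affine [1-t]∂-t/[1-t] k) n)
               (trans (⊛-scaleˡ (ℕ→ℚ k) (Uᵏ ⊕ (t/[1-t] ^E (k ∸ 1))) G n)
                 (cong (ℕ→ℚ k *_) (⊛-distribʳ-⊕ Uᵏ (t/[1-t] ^E (k ∸ 1)) G n)))
    eigen : (Uᵏ ⊛ [1-t]∂ G) n ≡ ℕ→ℚ (2 ℕ.* r) * lahGF r k n
    eigen = trans (⊛-congʳ Uᵏ ([1-t]∂-powers.^E-eigen [1-t]∂-geomE (2 ℕ.* r)) n)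
                  (⊛-scaleʳ (ℕ→ℚ (2 ℕ.* r)) Uᵏ G n)

  Lah-recurrence : ∀ r → Recurrence (λ m → ℕ→ℚ m + ℕ→ℚ (2 ℕ.* r)) (Lah r)
  Lah-recurrence r =
    recurrence-from-derivation [1-t]∂ ℕ→ℚ [1-t]∂-shift (lahGF r) (ℕ→ℚ (2 ℕ.* r)) ([1-t]∂-lahGF r)

  Lah-0 : ∀ r k → Lah r 0 k ≡ inv! k * oneE k
  Lah-0 r k = cong (inv! k *_) (begin
    ((t/[1-t] ^E k) ⊛ (geomE ^E (2 ℕ.* r))) 0   ≡⟨ ⊛-at-0 (t/[1-t] ^E k) (geomE ^E (2 ℕ.* r)) ⟩
    (t/[1-t] ^E k) 0 * (geomE ^E (2 ℕ.* r)) 0   ≡⟨ cong₂ _*_ (^E-at-0 t/[1-t] k) (^E-at-0 geomE (2 ℕ.* r)) ⟩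
    0ℚ ^ℚ k * 1ℚ ^ℚ (2 ℕ.* r)                   ≡⟨ cong₂ _*_ (0^ℚ≡oneE k) (1^ℚ≡1 (2 ℕ.* r)) ⟩
    oneE k * 1ℚ                                 ≡⟨ *-identityʳ (oneE k) ⟩
    oneE k                                      ∎)

  Lah-lowerTriangular : ∀ r {m k} → m < k → Lah r m k ≡ 0ℚ
  Lah-lowerTriangular r = recurrence-lowerTriangular (Lah-recurrence r)
                            (λ k → trans (Lah-0 r (suc k)) (*-zeroʳ (inv! (suc k))))

  -- The alternating Stirling transform

  S₂-above : ∀ {n m} → n < m → S₂ n m ≡ 0
  S₂-above {zero}  {suc m} _ = refl
  S₂-above {suc n} {suc m} (s≤s n<m)
    rewrite S₂-above (ℕₚ.m<n⇒m<1+n n<m) | S₂-above n<m =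
      trans (ℕₚ.+-identityʳ (m ℕ.* 0)) (ℕₚ.*-zeroʳ m)

  ℕ→ℚ-S₂-suc : ∀ n m → ℕ→ℚ (S₂ (suc n) (suc m)) ≡ ℕ→ℚ (suc m) * ℕ→ℚ (S₂ n (suc m)) + ℕ→ℚ (S₂ n m)
  ℕ→ℚ-S₂-suc n m =
    trans (ℕ→ℚ-+ (suc m ℕ.* S₂ n (suc m)) (S₂ n m)) (cong (_+ ℕ→ℚ (S₂ n m)) (ℕ→ℚ-* (suc m) (S₂ n (suc m))))

  Σ≤-S₂-telescope : ∀ n (L : ℕ → ℚ) →
    Σ≤ n (λ m → sign (n ∸ m) * (ℕ→ℚ (suc m) * (ℕ→ℚ (S₂ n (suc m)) * L (suc m)) + ℕ→ℚ m * (ℕ→ℚ (S₂ n m) * L m)))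
      ≡ 0ℚ
  Σ≤-S₂-telescope n L = begin
    _                         ≡⟨ Σ≤-alternating-telescope n h ⟩
    h (suc n) + sign n * h 0  ≡⟨ cong₂ (λ x y → x + sign n * y) top-vanishes (*-zeroˡ (ℕ→ℚ (S₂ n 0) * L 0)) ⟩
    0ℚ + sign n * 0ℚ          ≡⟨ trans (+-identityˡ _) (*-zeroʳ (sign n)) ⟩
    0ℚ                        ∎
    where
    h : ℕ → ℚ
    h j = ℕ→ℚ j * (ℕ→ℚ (S₂ n j) * L j)
    top-vanishes : h (suc n) ≡ 0ℚ
    top-vanishes = trans (cong (λ j → ℕ→ℚ (suc n) * (ℕ→ℚ j * L (suc n))) (S₂-above (ℕₚ.n<1+n n)))
                         (trans (cong (ℕ→ℚ (suc n) *_) (*-zeroˡ (L (suc n)))) (*-zeroʳ (ℕ→ℚ (suc n))))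

  stirlingTransform : (ℕ → ℕ → ℚ) → ℕ → ℕ → ℚ
  stirlingTransform L n k = Σ≤ n (λ m → sign (n ∸ m) * (ℕ→ℚ (S₂ n m) * L m k))

  stirlingTransform-0 : ∀ L k → stirlingTransform L 0 k ≡ L 0 k
  stirlingTransform-0 L k = trans (*-identityˡ _) (*-identityˡ (L 0 k))

  stirlingTransform-recurrence : ∀ {c L} → Recurrence (λ m → ℕ→ℚ m + c) L →
                                 Recurrence (λ _ → c) (stirlingTransform L)
  stirlingTransform-recurrence {c} {L} recL .step n k = begin
    Σ≤ (suc n) f
      ≡⟨ Σ≤-head n f ⟩
    f 0 + Σ≤ n (λ m → f (suc m))
      ≡⟨ cong₂ _+_ f₀≡0 (Σ≤-cong n (λ m _ → expand m)) ⟩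
    0ℚ + Σ≤ n (λ m → (κ * b m + p m) + s m * (h (suc m) + h m))
      ≡⟨ trans (+-identityˡ _) (Σ≤-+ n _ _) ⟩
    Σ≤ n (λ m → κ * b m + p m) + Σ≤ n (λ m → s m * (h (suc m) + h m))
      ≡⟨ cong₂ _+_ (Σ≤-+ n _ p) (Σ≤-S₂-telescope n (λ j → L j k)) ⟩
    (Σ≤ n (λ m → κ * b m) + Σ≤ n p) + 0ℚ
      ≡⟨ +-identityʳ _ ⟩
    Σ≤ n (λ m → κ * b m) + Σ≤ n p
      ≡⟨ cong₂ _+_ (Σ≤-* n κ b) (Σ≤-prev k) ⟩
    κ * stirlingTransform L n k + prev (stirlingTransform L n) k ∎
    where
    κ = c + ℕ→ℚ k
    s : ℕ → ℚ
    s m = sign (n ∸ m)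
    f b p h : ℕ → ℚ
    f m = sign (suc n ∸ m) * (ℕ→ℚ (S₂ (suc n) m) * L m k)
    b m = s m * (ℕ→ℚ (S₂ n m) * L m k)
    p m = s m * (ℕ→ℚ (S₂ n m) * prev (L m) k)
    h j = ℕ→ℚ j * (ℕ→ℚ (S₂ n j) * L j k)
    f₀≡0 : f 0 ≡ 0ℚ
    f₀≡0 = trans (cong (sign (suc n) *_) (*-zeroˡ (L 0 k))) (*-zeroʳ (sign (suc n)))
    split : ∀ σ m S₁ S₀ L₁ → σ * ((m * S₁ + S₀) * L₁) ≡ σ * (m * (S₁ * L₁)) + σ * (S₀ * L₁)
    split = solve-∀ ℚ-ring
    regroup : ∀ σ m₁ S₁ S₀ L₁ m c K L₀ P →
              σ * (m₁ * (S₁ * L₁)) + σ * (S₀ * ((m + c + K) * L₀ + P))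
              ≡ ((c + K) * (σ * (S₀ * L₀)) + σ * (S₀ * P)) + σ * (m₁ * (S₁ * L₁) + m * (S₀ * L₀))
    regroup = solve-∀ ℚ-ring
    expand : ∀ m → f (suc m) ≡ (κ * b m + p m) + s m * (h (suc m) + h m)
    expand m = begin
      f (suc m)
        ≡⟨ cong (λ z → s m * (z * L (suc m) k)) (ℕ→ℚ-S₂-suc n m) ⟩
      s m * ((ℕ→ℚ (suc m) * ℕ→ℚ S₁ + ℕ→ℚ S₀) * L (suc m) k)
        ≡⟨ split (s m) (ℕ→ℚ (suc m)) (ℕ→ℚ S₁) (ℕ→ℚ S₀) (L (suc m) k) ⟩
      s m * (ℕ→ℚ (suc m) * (ℕ→ℚ S₁ * L (suc m) k)) + s m * (ℕ→ℚ S₀ * L (suc m) k)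
        ≡⟨ cong (λ z → s m * (ℕ→ℚ (suc m) * (ℕ→ℚ S₁ * L (suc m) k)) + s m * (ℕ→ℚ S₀ * z)) (recL .step m k) ⟩
      s m * (ℕ→ℚ (suc m) * (ℕ→ℚ S₁ * L (suc m) k)) + s m * (ℕ→ℚ S₀ * ((ℕ→ℚ m + c + ℕ→ℚ k) * L m k + prev (L m) k))
        ≡⟨ regroup (s m) (ℕ→ℚ (suc m)) (ℕ→ℚ S₁) (ℕ→ℚ S₀) (L (suc m) k) (ℕ→ℚ m) c (ℕ→ℚ k) (L m k) (prev (L m) k) ⟩
      (κ * b m + p m) + s m * (h (suc m) + h m) ∎
      where
      S₁ = S₂ n (suc m)
      S₀ = S₂ n m
    Σ≤-prev : ∀ k → Σ≤ n (λ m → s m * (ℕ→ℚ (S₂ n m) * prev (L m) k)) ≡ prev (stirlingTransform L n) k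
    Σ≤-prev zero    = Σ≤-zero n _ (λ m _ → trans (cong (s m *_) (*-zeroʳ (ℕ→ℚ (S₂ n m)))) (*-zeroʳ (s m)))
    Σ≤-prev (suc k) = refl

  stirlingTransform≡Σ[⋯] : ∀ {L} → (∀ {m k} → m < k → L m k ≡ 0ℚ) → ∀ {n k} → k ≤ n →
    stirlingTransform L n k ≡ Σ[ k ⋯ n ] (λ m → sign (n ∸ m) * (ℕ→ℚ (S₂ n m) * L m k))
  stirlingTransform≡Σ[⋯] {L} L-lower {n} {k} k≤n = sym (Σ[⋯]≡Σ≤ _ k≤n vanish)
    where
    vanish : ∀ m → m < k → sign (n ∸ m) * (ℕ→ℚ (S₂ n m) * L m k) ≡ 0ℚ
    vanish m m<k = trans (cong (λ z → sign (n ∸ m) * (ℕ→ℚ (S₂ n m) * z)) (L-lower m<k))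
                         (trans (cong (sign (n ∸ m) *_) (*-zeroʳ (ℕ→ℚ (S₂ n m)))) (*-zeroʳ (sign (n ∸ m))))

open import Data.Nat using (ℕ; _≤_; _∸_; _*_)
open import Data.Rational using (ℚ) renaming (_*_ to _*ℚ_)
open import Relation.Binary.PropositionalEquality using (_≡_; sym; trans)
open TriangleRecurrences

corollary9 : (n k r : ℕ) → k ≤ n →
    S₂poly n k (ℕ→ℚ (2 * r))
      ≡ Σ[ k ⋯ n ] (λ m → sign (n ∸ m) *ℚ (ℕ→ℚ (S₂ n m) *ℚ Lah r m k))
corollary9 n k r k≤n =
  trans (recurrence-unique (S₂poly-recurrence (ℕ→ℚ (2 * r))) (stirlingTransform-recurrence (Lah-recurrence r))
                           base n k)
        (stirlingTransform≡Σ[⋯] (Lah-lowerTriangular r) k≤n)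
  where
  base : ∀ j → S₂poly 0 j (ℕ→ℚ (2 * r)) ≡ stirlingTransform (Lah r) 0 j
  base j = trans (S₂poly-0 (ℕ→ℚ (2 * r)) j) (sym (trans (stirlingTransform-0 (Lah r) j) (Lah-0 r j)))
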